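{- For all integers $n\ge 2$, \[ f(00,n)=2^n-\tfrac12 n^2-\tfrac32 n+1. \]
   Context: For $\pi=\pi_1\cdots\pi_n\in S_n$, its index is the binary string $r^\pi=r_1\cdots r_{n-1}$ with $r_i=0$ if $\pi_i<\pi_{i+1}$ and $r_i=1$ if $\pi_i>\pi_{i+1}$. For a binary string $r$ ending in $0$, $f(r,n)$ is the number of $\pi\in S_n$ whose index is $rr'$ for some binary string $r'$ containing exactly one $1$. -}

module Defs where

open import Data.Bool using (Bool; true; false; _∧_; not; if_then_else_)
open import Data.Nat using (ℕ; zero; suc; _<ᵇ_; _≡ᵇ_; _+_)
open import Data.Fin using (Fin; toℕ)
open import Data.Fin.Properties using (_≟_)
open import Data.List using (List; []; _∷_; map; concatMap; length; drop; filter; allFin)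
open import Data.Bool.ListAction using (any)
open import Data.Vec using (Vec; []; _∷_; toList)
open import Relation.Nullary.Decidable using (isYes)

-- Binary strings: lists of booleans, with true = 1 and false = 0.
BinStr : Set
BinStr = List Bool

words : (m k : ℕ) → List (Vec (Fin k) m)
words zero    k = [] ∷ []
words (suc m) k = concatMap (λ v → map (λ x → x ∷ v) (allFin k)) (words m k)

distinct : {k : ℕ} → List (Fin k) → Bool
distinct []       = true
distinct (x ∷ xs) = not (any (λ y → isYes (x ≟ y)) xs) ∧ distinct xs

-- S_n, realised as one-line notations π₁⋯πₙ with values in {0,…,n-1}
-- (relabelling 1..n as 0..n-1 preserves all comparisons).
Sym : (n : ℕ) → List (Vec (Fin n) n)
Sym n = filter (λ π → Data.Bool._≟_ (distinct (toList π)) true) (words n n)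

indexL : {k : ℕ} → List (Fin k) → BinStr
indexL []            = []
indexL (x ∷ [])      = []
indexL (x ∷ y ∷ xs)  = (toℕ y <ᵇ toℕ x) ∷ indexL (y ∷ xs)

index : {k n : ℕ} → Vec (Fin k) n → BinStr
index π = indexL (toList π)

ones : BinStr → ℕ
ones []           = 0
ones (true ∷ s)   = suc (ones s)
ones (false ∷ s)  = ones s

prefix : BinStr → BinStr → Bool
prefix []       _        = true
prefix (_ ∷ _)  []       = false
prefix (a ∷ r)  (b ∷ s)  = isYes (Data.Bool._≟_ a b) ∧ prefix r s

hasForm : BinStr → BinStr → Bool
hasForm r s = prefix r s ∧ (ones (drop (length r) s) ≡ᵇ 1)

f : BinStr → ℕ → ℕ
f r n = length (filter (λ π → Data.Bool._≟_ (hasForm r (index π)) true) (Sym n))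

-- After a letter x, with the set F of letters used so far, the number of admissible continuations
-- depends only on the number u of unused letters and the number a of unused letters above x:
-- increasing continuations of length r number C(a, r), and continuations by all u = r unused
-- letters with exactly one descent number 2^a - [a = r](r + 1).  Choosing the next letter y among
-- the unused letters above x, the number of unused letters above y runs through 0, …, a - 1
-- exactly once, so prescribing one more initial ascent replaces a count by its prefix sum; with
-- the hockey-stick identity, j prescribed ascents followed by exactly one descent leave
-- 2^a - C(a, j + r)(r + 1) - Σ_{i<j} C(a, i) continuations.  Summing over the first letter gives
-- f(0^j, n) = 2^n - (n - j) - Σ_{i≤j} C(n, i), and j = 2 is the claim.

module Submission where

module AscentPrefixes where

  open import Defs
  import Data.Bool.Properties as Bool
  open import Algebra.Lattice.Properties.BooleanAlgebra Bool.∨-∧-booleanAlgebra using (deMorgan₂)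
  open import Data.Bool using (Bool; true; false; _∧_; _∨_; not; if_then_else_) renaming (_≟_ to _≟ᵇ_)
  open import Data.Bool.ListAction using (all; any)
  open import Data.Bool.Properties using (∧-zeroʳ; ∧-assoc)
  open import Data.Fin using (Fin; toℕ) renaming (zero to fzero; suc to fsuc)
  open import Data.Fin.Properties using (_≟_)
  open import Data.List as List using (List; []; _∷_; replicate)
  import Data.List.Properties as List
  open import Data.Nat.ListAction using () renaming (sum to ∑ˡ)
  open import Data.Nat.ListAction.Properties using () renaming (sum-++ to ∑ˡ-++)
  open import Data.Nat using (ℕ; zero; suc; _+_; _*_; _^_; _<ᵇ_; _≡ᵇ_; _≤_; z≤n)
  open import Data.Nat.Combinatorics using (_C_; nCn≡1; nC1≡n; nCk+nC[k+1]≡[n+1]C[k+1])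
  open import Data.Nat.Properties
    using (+-identityʳ; +-comm; +-assoc; +-mono-≤; ≤-refl; n≤0⇒n≡0; suc-injective; +-*-semiring)
  open import Data.Vec using (Vec; []; _∷_; toList)
  open import Function using (_∘_)
  open import Data.Nat.Tactic.RingSolver using (solve-∀)
  open import Relation.Nullary.Decidable using (isYes; ⌊⌋-map′)
  open import Relation.Binary.PropositionalEquality using (_≡_; refl; sym; trans; cong; cong₂; subst)
  open Relation.Binary.PropositionalEquality.≡-Reasoning

  open import Algebra.Properties.Semiring.Sum +-*-semiring
    using (sum; sum-syntax; sum-cong-≗; sum-replicate-zero; ∑-distrib-+; ∑-comm; *-distribʳ-sum)

  iverson : Bool → ℕ
  iverson true  = 1
  iverson false = 0

  sum-map-tabulate : ∀ {A : Set} {n} (φ : A → ℕ) (t : Fin n → A) →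
    ∑ˡ (List.map φ (List.tabulate t)) ≡ ∑[ i < n ] φ (t i)
  sum-map-tabulate {n = zero}  φ t = refl
  sum-map-tabulate {n = suc n} φ t = cong (φ (t fzero) +_) (sum-map-tabulate φ (t ∘ fsuc))

  sum-map-concatMap : ∀ {A B : Set} (g : B → ℕ) (h : A → List B) (l : List A) →
    ∑ˡ (List.map g (List.concatMap h l)) ≡ ∑ˡ (List.map (λ a → ∑ˡ (List.map g (h a))) l)
  sum-map-concatMap g h []      = refl
  sum-map-concatMap g h (a ∷ l) = begin
    ∑ˡ (List.map g (h a List.++ List.concatMap h l))
      ≡⟨ cong ∑ˡ (List.map-++ g (h a) _) ⟩
    ∑ˡ (List.map g (h a) List.++ List.map g (List.concatMap h l))
      ≡⟨ ∑ˡ-++ (List.map g (h a)) _ ⟩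
    ∑ˡ (List.map g (h a)) + ∑ˡ (List.map g (List.concatMap h l))
      ≡⟨ cong (∑ˡ (List.map g (h a)) +_) (sum-map-concatMap g h l) ⟩
    ∑ˡ (List.map (λ a → ∑ˡ (List.map g (h a))) (a ∷ l)) ∎

  sum-map-∑ : ∀ {A : Set} {n} (g : A → Fin n → ℕ) (l : List A) →
    ∑ˡ (List.map (λ a → ∑[ i < n ] g a i) l) ≡ ∑[ i < n ] ∑ˡ (List.map (λ a → g a i) l)
  sum-map-∑ {n = n} g []      = sym (sum-replicate-zero n)
  sum-map-∑         g (a ∷ l) = trans (cong (sum (g a) +_) (sum-map-∑ g l)) (sym (∑-distrib-+ (g a) _))

  sumWords : ∀ m {k} → (Vec (Fin k) m → ℕ) → ℕ
  sumWords zero    g = g []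
  sumWords (suc m) {k} g = ∑[ x < k ] sumWords m (λ v → g (x ∷ v))

  sum-map-words : ∀ m k (g : Vec (Fin k) m → ℕ) → ∑ˡ (List.map g (words m k)) ≡ sumWords m g
  sum-map-words zero    k g = +-identityʳ (g [])
  sum-map-words (suc m) k g = begin
    ∑ˡ (List.map g (List.concatMap (λ v → List.map (_∷ v) (List.allFin k)) (words m k)))
      ≡⟨ sum-map-concatMap g _ (words m k) ⟩
    ∑ˡ (List.map (λ v → ∑ˡ (List.map g (List.map (_∷ v) (List.allFin k)))) (words m k))
      ≡⟨ cong ∑ˡ (List.map-cong (λ v → trans (cong ∑ˡ (sym (List.map-∘ (List.allFin k))))
                                                    (sum-map-tabulate (λ x → g (x ∷ v)) (λ x → x)))
                                      (words m k)) ⟩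
    ∑ˡ (List.map (λ v → ∑[ x < k ] g (x ∷ v)) (words m k))
      ≡⟨ sum-map-∑ (λ v x → g (x ∷ v)) (words m k) ⟩
    ∑[ x < k ] ∑ˡ (List.map (λ v → g (x ∷ v)) (words m k))
      ≡⟨ sum-cong-≗ (λ x → sum-map-words m k (λ v → g (x ∷ v))) ⟩
    sumWords (suc m) g ∎

  filterᵇ : ∀ {A : Set} → (A → Bool) → List A → List A
  filterᵇ p = List.filter (λ a → p a ≟ᵇ true)

  length-filter-filter : ∀ {A : Set} (p q : A → Bool) (l : List A) →
    List.length (filterᵇ q (filterᵇ p l)) ≡ ∑ˡ (List.map (λ a → iverson (p a ∧ q a)) l)
  length-filter-filter p q []      = refl
  length-filter-filter p q (a ∷ l) = by-cases (p a) (q a) refl refl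
    where
    by-cases : ∀ b c → p a ≡ b → q a ≡ c →
      List.length (filterᵇ q (filterᵇ p (a ∷ l))) ≡ ∑ˡ (List.map (λ a → iverson (p a ∧ q a)) (a ∷ l))
    by-cases false c     pa qa rewrite pa      = length-filter-filter p q l
    by-cases true  false pa qa rewrite pa | qa = length-filter-filter p q l
    by-cases true  true  pa qa rewrite pa | qa = cong suc (length-filter-filter p q l)

  sumWords-cong : ∀ m {k} {g h : Vec (Fin k) m → ℕ} → (∀ w → g w ≡ h w) → sumWords m g ≡ sumWords m h
  sumWords-cong zero    eq = eq []
  sumWords-cong (suc m) eq = sum-cong-≗ (λ x → sumWords-cong m (λ v → eq (x ∷ v)))

  sumWords-zero : ∀ m {k} → sumWords m {k} (λ _ → 0) ≡ 0
  sumWords-zero zero        = refl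
  sumWords-zero (suc m) {k} = trans (sum-cong-≗ {k} (λ _ → sumWords-zero m {k})) (sum-replicate-zero k)

  sumWords-∧ : ∀ m {k} b (g : Vec (Fin k) m → Bool) →
    sumWords m (λ w → iverson (b ∧ g w)) ≡ (if b then sumWords m (iverson ∘ g) else 0)
  sumWords-∧ m true  g = refl
  sumWords-∧ m false g = sumWords-zero m

  ∑-last : ∀ (φ : ℕ → ℕ) a → ∑[ t < suc a ] φ (toℕ t) ≡ ∑[ t < a ] φ (toℕ t) + φ a
  ∑-last φ zero    = +-comm (φ 0) 0
  ∑-last φ (suc a) = trans (cong (φ 0 +_) (∑-last (φ ∘ suc) a)) (sym (+-assoc (φ 0) _ _))

  hockey-stick : ∀ r a → ∑[ t < a ] (toℕ t C r) ≡ a C suc r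
  hockey-stick r zero    = refl
  hockey-stick r (suc a) = begin
    ∑[ t < suc a ] (toℕ t C r)    ≡⟨ ∑-last (_C r) a ⟩
    ∑[ t < a ] (toℕ t C r) + a C r ≡⟨ cong (_+ a C r) (hockey-stick r a) ⟩
    a C suc r + a C r              ≡⟨ +-comm (a C suc r) _ ⟩
    a C r + a C suc r              ≡⟨ nCk+nC[k+1]≡[n+1]C[k+1] a r ⟩
    suc a C suc r                  ∎

  geometric-sum : ∀ a → ∑[ t < a ] (2 ^ toℕ t) + 1 ≡ 2 ^ a
  geometric-sum zero    = refl
  geometric-sum (suc a) = begin
    ∑[ t < suc a ] (2 ^ toℕ t) + 1       ≡⟨ cong (_+ 1) (∑-last (2 ^_) a) ⟩
    ∑[ t < a ] (2 ^ toℕ t) + 2 ^ a + 1   ≡⟨ +-assoc (∑[ t < a ] (2 ^ toℕ t)) _ 1 ⟩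
    ∑[ t < a ] (2 ^ toℕ t) + (2 ^ a + 1) ≡⟨ cong (∑[ t < a ] (2 ^ toℕ t) +_) (+-comm (2 ^ a) 1) ⟩
    ∑[ t < a ] (2 ^ toℕ t) + (1 + 2 ^ a) ≡⟨ +-assoc (∑[ t < a ] (2 ^ toℕ t)) 1 _ ⟨
    ∑[ t < a ] (2 ^ toℕ t) + 1 + 2 ^ a   ≡⟨ cong (_+ 2 ^ a) (geometric-sum a) ⟩
    2 ^ a + 2 ^ a                      ≡⟨ cong (2 ^ a +_) (sym (+-identityʳ (2 ^ a))) ⟩
    2 ^ suc a                          ∎

  module _ {k : ℕ} where

    count : (Fin k → Bool) → ℕ
    count P = ∑[ z < k ] iverson (P z)

    count-cong : {P Q : Fin k → Bool} → (∀ z → P z ≡ Q z) → count P ≡ count Q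
    count-cong eq = sum-cong-≗ (cong iverson ∘ eq)

    above : (Fin k → Bool) → Fin k → Fin k → Bool
    above P y z = (toℕ y <ᵇ toℕ z) ∧ P z

  ∑-if-cong : ∀ {k} (P : Fin k → Bool) {g h : Fin k → ℕ} → (∀ y → P y ≡ true → g y ≡ h y) →
    ∑[ y < k ] (if P y then g y else 0) ≡ ∑[ y < k ] (if P y then h y else 0)
  ∑-if-cong P {g} {h} eq = sum-cong-≗ pointwise
    where
    pointwise : ∀ y → (if P y then g y else 0) ≡ (if P y then h y else 0)
    pointwise y with P y in Py
    ... | true  = eq y Py
    ... | false = refl

  if-∧-split : ∀ b c n → (if b ∧ c then n else 0) + (if not b ∧ c then n else 0) ≡ (if c then n else 0)
  if-∧-split true  c n = +-identityʳ _
  if-∧-split false c n = refl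

  count-all : ∀ k → count {k} (λ _ → true) ≡ k
  count-all zero    = refl
  count-all (suc k) = cong suc (count-all k)

  count-mono : ∀ {k} (P Q : Fin k → Bool) → (∀ z → P z ≡ true → Q z ≡ true) → count P ≤ count Q
  count-mono {zero}  P Q P⊆Q = z≤n
  count-mono {suc k} P Q P⊆Q = +-mono-≤ head (count-mono (P ∘ fsuc) (Q ∘ fsuc) (P⊆Q ∘ fsuc))
    where
    head : iverson (P fzero) ≤ iverson (Q fzero)
    head with P fzero in P0
    ... | false = z≤n
    ... | true rewrite P⊆Q fzero P0 = ≤-refl

  count-remove : ∀ {k} (Q : Fin k → Bool) (y : Fin k) →
    count (λ z → not (toℕ y ≡ᵇ toℕ z) ∧ Q z) + iverson (Q y) ≡ count Q
  count-remove {suc k} Q fzero    = +-comm (count (Q ∘ fsuc)) _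
  count-remove {suc k} Q (fsuc y) =
    trans (+-assoc (iverson (Q fzero)) _ _) (cong (iverson (Q fzero) +_) (count-remove (Q ∘ fsuc) y))

  -- As y runs over P, the number of elements of P above y takes each value below count P once.
  ∑-over-ranks : ∀ {k} (P : Fin k → Bool) (g : ℕ → ℕ) →
    ∑[ y < k ] (if P y then g (count (above P y)) else 0) ≡ ∑[ t < count P ] g (toℕ t)
  ∑-over-ranks {zero}  P g = refl
  ∑-over-ranks {suc k} P g with P fzero
  ... | false = ∑-over-ranks (P ∘ fsuc) g
  ... | true  = trans (cong (g c +_) (∑-over-ranks (P ∘ fsuc) g))
                      (trans (+-comm (g c) _) (sym (∑-last g c)))
    where c = count (P ∘ fsuc)

  ∑-over-ranks-+ : ∀ {k} (P : Fin k → Bool) (V : Fin k → ℕ) (φ ψ : ℕ → ℕ) →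
    (∀ y → P y ≡ true → V y + φ (count (above P y)) ≡ ψ (count (above P y))) →
    ∑[ y < k ] (if P y then V y else 0) + ∑[ t < count P ] φ (toℕ t) ≡ ∑[ t < count P ] ψ (toℕ t)
  ∑-over-ranks-+ {k} P V φ ψ eq = begin
    ∑[ y < k ] Vᴾ y + ∑[ t < count P ] φ (toℕ t)
      ≡⟨ cong (∑[ y < k ] Vᴾ y +_) (∑-over-ranks P φ) ⟨
    ∑[ y < k ] Vᴾ y + ∑[ y < k ] (if P y then φ (rank y) else 0)
      ≡⟨ ∑-distrib-+ Vᴾ (λ y → if P y then φ (rank y) else 0) ⟨
    ∑[ y < k ] (Vᴾ y + (if P y then φ (rank y) else 0))
      ≡⟨ sum-cong-≗ pointwise ⟩
    ∑[ y < k ] (if P y then ψ (rank y) else 0)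
      ≡⟨ ∑-over-ranks P ψ ⟩
    ∑[ t < count P ] ψ (toℕ t) ∎
    where
    Vᴾ : Fin k → ℕ
    Vᴾ y = if P y then V y else 0
    rank : Fin k → ℕ
    rank y = count (above P y)
    pointwise : ∀ y → Vᴾ y + (if P y then φ (rank y) else 0) ≡ (if P y then ψ (rank y) else 0)
    pointwise y with P y in Py
    ... | true  = eq y Py
    ... | false = refl

  deficit : ℕ → ℕ → ℕ → ℕ
  deficit j r a = (a C (j + r)) * suc r + ∑[ i < j ] (a C toℕ i)

  ∑-deficit : ∀ j r a → ∑[ t < a ] deficit j r (toℕ t) + 1 ≡ deficit (suc j) r a
  ∑-deficit j r a = begin
    ∑[ t < a ] (binomialPart (toℕ t) + lowerPart (toℕ t)) + 1
      ≡⟨ cong (_+ 1) (∑-distrib-+ {a} (binomialPart ∘ toℕ) (lowerPart ∘ toℕ)) ⟩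
    ∑[ t < a ] binomialPart (toℕ t) + ∑[ t < a ] lowerPart (toℕ t) + 1
      ≡⟨ cong₂ (λ u v → u + v + 1) binomials lowers ⟩
    (a C suc (j + r)) * suc r + ∑[ i < j ] (a C suc (toℕ i)) + 1
      ≡⟨ +-assoc ((a C suc (j + r)) * suc r) _ 1 ⟩
    (a C suc (j + r)) * suc r + (∑[ i < j ] (a C suc (toℕ i)) + 1)
      ≡⟨ cong ((a C suc (j + r)) * suc r +_) (+-comm (∑[ i < j ] (a C suc (toℕ i))) 1) ⟩
    deficit (suc j) r a ∎
    where
    binomialPart lowerPart : ℕ → ℕ
    binomialPart t = (t C (j + r)) * suc r
    lowerPart t = ∑[ i < j ] (t C toℕ i)
    binomials : ∑[ t < a ] binomialPart (toℕ t) ≡ (a C suc (j + r)) * suc r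
    binomials = trans (sym (*-distribʳ-sum {a} (suc r) (λ t → toℕ t C (j + r))))
                      (cong (_* suc r) (hockey-stick (j + r) a))
    lowers : ∑[ t < a ] lowerPart (toℕ t) ≡ ∑[ i < j ] (a C suc (toℕ i))
    lowers = trans (∑-comm {a} {j} (λ t i → toℕ t C toℕ i)) (sum-cong-≗ {j} (λ i → hockey-stick (toℕ i) a))

  deficit-step : ∀ {k} (P : Fin k → Bool) (V : Fin k → ℕ) j r →
    (∀ y → P y ≡ true → V y + deficit j r (count (above P y)) ≡ 2 ^ count (above P y)) →
    ∑[ y < k ] (if P y then V y else 0) + deficit (suc j) r (count P) ≡ 2 ^ count P
  deficit-step {k} P V j r eq = begin
    Σᴾ + deficit (suc j) r (count P)
      ≡⟨ cong (Σᴾ +_) (∑-deficit j r (count P)) ⟨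
    Σᴾ + (∑[ t < count P ] deficit j r (toℕ t) + 1)
      ≡⟨ +-assoc Σᴾ _ 1 ⟨
    Σᴾ + ∑[ t < count P ] deficit j r (toℕ t) + 1
      ≡⟨ cong (_+ 1) (∑-over-ranks-+ P V (deficit j r) (2 ^_) eq) ⟩
    ∑[ t < count P ] (2 ^ toℕ t) + 1
      ≡⟨ geometric-sum (count P) ⟩
    2 ^ count P ∎
    where
    Σᴾ : ℕ
    Σᴾ = ∑[ y < k ] (if P y then V y else 0)

  ≮ᵇ-<ᵇ-trans : ∀ x y z → (y <ᵇ x) ≡ false → (y <ᵇ z) ≡ true → (z <ᵇ x) ≡ false
  ≮ᵇ-<ᵇ-trans zero    y       z       _   _   = refl
  ≮ᵇ-<ᵇ-trans (suc x) zero    z       ()  _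
  ≮ᵇ-<ᵇ-trans (suc x) (suc y) (suc z) y≮x y<z = ≮ᵇ-<ᵇ-trans x y z y≮x y<z

  ≮ᵇ-∧-≢ᵇ : ∀ m n b → not (m <ᵇ n) ∧ not ((n ≡ᵇ m) ∨ b) ≡ (n <ᵇ m) ∧ not b
  ≮ᵇ-∧-≢ᵇ zero    zero    b = refl
  ≮ᵇ-∧-≢ᵇ zero    (suc n) b = refl
  ≮ᵇ-∧-≢ᵇ (suc m) zero    b = refl
  ≮ᵇ-∧-≢ᵇ (suc m) (suc n) b = ≮ᵇ-∧-≢ᵇ m n b

  isYes-≟ : ∀ {k} (x y : Fin k) → isYes (x ≟ y) ≡ (toℕ x ≡ᵇ toℕ y)
  isYes-≟ fzero    fzero    = refl
  isYes-≟ fzero    (fsuc y) = refl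
  isYes-≟ (fsuc x) fzero    = refl
  isYes-≟ (fsuc x) (fsuc y) = trans (⌊⌋-map′ _ _ (x ≟ y)) (isYes-≟ x y)

  module _ {k : ℕ} where

    unused : (Fin k → Bool) → Fin k → Bool
    unused F z = not (F z)

    _∪｛_｝ : (Fin k → Bool) → Fin k → Fin k → Bool
    (F ∪｛ y ｝) z = (toℕ y ≡ᵇ toℕ z) ∨ F z

    freshAbove : (Fin k → Bool) → Fin k → Fin k → Bool
    freshAbove F x z = not (toℕ z <ᵇ toℕ x) ∧ not (F z)

    ∅ : Fin k → Bool
    ∅ _ = false

    fresh : (Fin k → Bool) → List (Fin k) → Bool
    fresh F = all (unused F)

    fresh-∅ : ∀ l → fresh ∅ l ≡ true
    fresh-∅ []      = refl
    fresh-∅ (_ ∷ l) = fresh-∅ l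

    -- F is the set of letters already used, x the last letter written.
    completions : (BinStr → Bool) → Fin k → (Fin k → Bool) → ℕ → ℕ
    completions Q x F m =
      sumWords m (λ w → iverson (fresh F (toList w) ∧ distinct (toList w) ∧ Q (indexL (x ∷ toList w))))

    freshAbove-∪ : ∀ F y z → freshAbove (F ∪｛ y ｝) y z ≡ above (unused F) y z
    freshAbove-∪ F y z = ≮ᵇ-∧-≢ᵇ (toℕ z) (toℕ y) (F z)

    freshAbove⇒≮ᵇ : ∀ F x y → freshAbove F x y ≡ true → (toℕ y <ᵇ toℕ x) ≡ false
    freshAbove⇒≮ᵇ F x y eligible with toℕ y <ᵇ toℕ x
    ... | false = refl
    ... | true  with () ← eligible

    freshAbove⇒unused : ∀ F x y → freshAbove F x y ≡ true → F y ≡ false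
    freshAbove⇒unused F x y eligible with F y | not (toℕ y <ᵇ toℕ x)
    ... | false | _     = refl
    ... | true  | false with () ← eligible
    ... | true  | true  with () ← eligible

    above-unused : ∀ F x y → (toℕ y <ᵇ toℕ x) ≡ false → ∀ z → above (unused F) y z ≡ above (freshAbove F x) y z
    above-unused F x y y≮x z with toℕ y <ᵇ toℕ z in y<z
    ... | false = refl
    ... | true rewrite ≮ᵇ-<ᵇ-trans (toℕ x) (toℕ y) (toℕ z) y≮x y<z = refl

    count-freshAbove-∪ : ∀ F x y → freshAbove F x y ≡ true →
      count (freshAbove (F ∪｛ y ｝) y) ≡ count (above (freshAbove F x) y)
    count-freshAbove-∪ F x y eligible =
      count-cong (λ z → trans (freshAbove-∪ F y z) (above-unused F x y (freshAbove⇒≮ᵇ F x y eligible) z))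

    count-unused-∪ : ∀ F y → F y ≡ false → count (unused F) ≡ suc (count (unused (F ∪｛ y ｝)))
    count-unused-∪ F y Fy≡false = begin
      count (unused F)                                              ≡⟨ count-remove (unused F) y ⟨
      count (λ z → not (toℕ y ≡ᵇ toℕ z) ∧ not (F z)) + iverson (not (F y))
        ≡⟨ cong₂ _+_ (count-cong (λ z → sym (deMorgan₂ (toℕ y ≡ᵇ toℕ z) (F z)))) (cong (iverson ∘ not) Fy≡false) ⟩
      count (unused (F ∪｛ y ｝)) + 1                               ≡⟨ +-comm _ 1 ⟩
      suc (count (unused (F ∪｛ y ｝)))                             ∎

    fresh-∪ : ∀ F y l → fresh (F ∪｛ y ｝) l ≡ fresh F l ∧ not (any (λ z → isYes (y ≟ z)) l)
    fresh-∪ F y []      = refl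
    fresh-∪ F y (z ∷ l) rewrite fresh-∪ F y l | isYes-≟ y z = reassoc (toℕ y ≡ᵇ toℕ z) (F z) _ _
      where
      reassoc : ∀ e f b c → not (e ∨ f) ∧ (b ∧ not c) ≡ (not f ∧ b) ∧ not (e ∨ c)
      reassoc true  f b c = sym (∧-zeroʳ (not f ∧ b))
      reassoc false f b c = sym (∧-assoc (not f) b (not c))

    completions-suc : ∀ Q x F m → completions Q x F (suc m) ≡
      ∑[ y < k ] (if not (F y) then completions (λ s → Q ((toℕ y <ᵇ toℕ x) ∷ s)) y (F ∪｛ y ｝) m else 0)
    completions-suc Q x F m = sum-cong-≗ λ y →
      trans (sumWords-cong m (λ v → cong iverson (first-letter y (toList v))))
            (sumWords-∧ m (not (F y)) _)
      where
      reassoc : ∀ a f n d q → (a ∧ f) ∧ ((n ∧ d) ∧ q) ≡ a ∧ ((f ∧ n) ∧ d ∧ q)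
      reassoc false f     n     d q = refl
      reassoc true  false n     d q = refl
      reassoc true  true  false d q = refl
      reassoc true  true  true  d q = refl
      first-letter : ∀ y l →
        fresh F (y ∷ l) ∧ distinct (y ∷ l) ∧ Q (indexL (x ∷ y ∷ l))
          ≡ not (F y) ∧ (fresh (F ∪｛ y ｝) l ∧ distinct l ∧ Q ((toℕ y <ᵇ toℕ x) ∷ indexL (y ∷ l)))
      first-letter y l rewrite fresh-∪ F y l = reassoc (not (F y)) (fresh F l) _ _ _

    count-unused-∪-freshAbove : ∀ {n} F x y → count (unused F) ≡ suc n → freshAbove F x y ≡ true →
      count (unused (F ∪｛ y ｝)) ≡ n
    count-unused-∪-freshAbove F x y unused≡ eligible =
      suc-injective (trans (sym (count-unused-∪ F y (freshAbove⇒unused F x y eligible))) unused≡)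

    completions-cong : ∀ Q Q′ x F m → (∀ s → Q s ≡ Q′ s) → completions Q x F m ≡ completions Q′ x F m
    completions-cong Q Q′ x F m eq =
      sumWords-cong m (λ w → cong (λ q → iverson (fresh F (toList w) ∧ distinct (toList w) ∧ q)) (eq _))

    completions-empty : ∀ Q x F m → (∀ s → Q s ≡ false) → completions Q x F m ≡ 0
    completions-empty Q x F m never = begin
      completions Q x F m            ≡⟨ completions-cong Q _ x F m never ⟩
      completions (λ _ → false) x F m
        ≡⟨ sumWords-cong m (λ w → cong iverson (trans (cong (fresh F (toList w) ∧_) (∧-zeroʳ _)) (∧-zeroʳ _))) ⟩
      sumWords m (λ _ → 0)           ≡⟨ sumWords-zero m ⟩
      0                              ∎

    completions-ascent : ∀ Q Q′ x F m → (∀ s → Q (true ∷ s) ≡ false) → (∀ s → Q (false ∷ s) ≡ Q′ s) →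
      completions Q x F (suc m) ≡ ∑[ y < k ] (if freshAbove F x y then completions Q′ y (F ∪｛ y ｝) m else 0)
    completions-ascent Q Q′ x F m descent ascent = trans (completions-suc Q x F m) (sum-cong-≗ next)
      where
      next : ∀ y → (if not (F y) then completions (λ s → Q ((toℕ y <ᵇ toℕ x) ∷ s)) y (F ∪｛ y ｝) m else 0)
                     ≡ (if freshAbove F x y then completions Q′ y (F ∪｛ y ｝) m else 0)
      next y with toℕ y <ᵇ toℕ x | F y
      ... | true  | true  = refl
      ... | true  | false = completions-empty _ y (F ∪｛ y ｝) m descent
      ... | false | true  = refl
      ... | false | false = completions-cong _ Q′ y (F ∪｛ y ｝) m ascent

  noDescent : BinStr → Bool
  noDescent s = ones s ≡ᵇ 0

  module _ {k : ℕ} where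

    completions-noDescent : ∀ r (x : Fin k) F → completions noDescent x F r ≡ count (freshAbove F x) C r
    completions-noDescent zero    x F = refl
    completions-noDescent (suc r) x F = begin
      completions noDescent x F (suc r)
        ≡⟨ completions-ascent noDescent noDescent x F r (λ _ → refl) (λ _ → refl) ⟩
      ∑[ y < k ] (if freshAbove F x y then completions noDescent y (F ∪｛ y ｝) r else 0)
        ≡⟨ ∑-if-cong (freshAbove F x) (λ y eligible →
             trans (completions-noDescent r y (F ∪｛ y ｝)) (cong (_C r) (count-freshAbove-∪ F x y eligible))) ⟩
      ∑[ y < k ] (if freshAbove F x y then count (above (freshAbove F x) y) C r else 0)
        ≡⟨ ∑-over-ranks (freshAbove F x) (_C r) ⟩
      ∑[ t < count (freshAbove F x) ] (toℕ t C r)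
        ≡⟨ hockey-stick r (count (freshAbove F x)) ⟩
      count (freshAbove F x) C suc r ∎

    completions-oneDescent-suc : ∀ (x : Fin k) F m → completions (hasForm []) x F (suc m) ≡
      ∑[ y < k ] (if (toℕ y <ᵇ toℕ x) ∧ not (F y) then completions noDescent y (F ∪｛ y ｝) m else 0)
        + ∑[ y < k ] (if freshAbove F x y then completions (hasForm []) y (F ∪｛ y ｝) m else 0)
    completions-oneDescent-suc x F m =
      trans (completions-suc (hasForm []) x F m) (trans (sum-cong-≗ next) (∑-distrib-+ {k} _ _))
      where
      next : ∀ y → (if not (F y) then completions (λ s → hasForm [] ((toℕ y <ᵇ toℕ x) ∷ s)) y (F ∪｛ y ｝) m else 0)
        ≡ (if (toℕ y <ᵇ toℕ x) ∧ not (F y) then completions noDescent y (F ∪｛ y ｝) m else 0)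
          + (if freshAbove F x y then completions (hasForm []) y (F ∪｛ y ｝) m else 0)
      next y with toℕ y <ᵇ toℕ x
      ... | true  = sym (+-identityʳ _)
      ... | false = refl

    completions-oneDescent : ∀ r (x : Fin k) F → count (unused F) ≡ r →
      completions (hasForm []) x F r + deficit 0 r (count (freshAbove F x)) ≡ 2 ^ count (freshAbove F x)
    completions-oneDescent zero x F unused≡0
      rewrite n≤0⇒n≡0 (subst (count (freshAbove F x) ≤_) unused≡0
                          (count-mono (freshAbove F x) (unused F) (λ z → cong not ∘ freshAbove⇒unused F x z)))
      = refl
    completions-oneDescent (suc r) x F unused≡ = begin
      completions (hasForm []) x F (suc r) + deficit 0 (suc r) a
        ≡⟨ cong (_+ deficit 0 (suc r) a) (completions-oneDescent-suc x F r) ⟩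
      Σᶻ + Σᵉ + (c * suc (suc r) + 0)
        ≡⟨ regroup Σᶻ Σᵉ c ⟩
      Σᵉ + (c * suc r + (Σᶻ + c))
        ≡⟨ cong (λ t → Σᵉ + (c * suc r + t)) below-and-above ⟩
      Σᵉ + deficit 1 r a
        ≡⟨ deficit-step (freshAbove F x) next 0 r (λ y eligible →
             subst (λ t → next y + deficit 0 r t ≡ 2 ^ t) (count-freshAbove-∪ F x y eligible)
               (completions-oneDescent r y (F ∪｛ y ｝) (count-unused-∪-freshAbove F x y unused≡ eligible))) ⟩
      2 ^ a ∎
      where
      next : Fin k → ℕ
      next y = completions (hasForm []) y (F ∪｛ y ｝) r
      a c Σᶻ Σᵉ : ℕ
      a = count (freshAbove F x)
      c = a C suc r
      Σᶻ = ∑[ y < k ] (if (toℕ y <ᵇ toℕ x) ∧ not (F y) then completions noDescent y (F ∪｛ y ｝) r else 0)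
      Σᵉ = ∑[ y < k ] (if freshAbove F x y then completions (hasForm []) y (F ∪｛ y ｝) r else 0)
      regroup : ∀ z e c → z + e + (c * suc (suc r) + 0) ≡ e + (c * suc r + (z + c))
      regroup = solve-∀
      W : Fin k → ℕ
      W y = count (above (unused F) y) C r
      below : Σᶻ ≡ ∑[ y < k ] (if (toℕ y <ᵇ toℕ x) ∧ not (F y) then W y else 0)
      below = sum-cong-≗ λ y → cong (λ t → if (toℕ y <ᵇ toℕ x) ∧ not (F y) then t else 0)
        (trans (completions-noDescent r y (F ∪｛ y ｝)) (cong (_C r) (count-cong (freshAbove-∪ F y))))
      above-x : c ≡ ∑[ y < k ] (if freshAbove F x y then W y else 0)
      above-x = begin
        a C suc r                                                              ≡⟨ hockey-stick r a ⟨
        ∑[ t < a ] (toℕ t C r)                                                 ≡⟨ ∑-over-ranks (freshAbove F x) (_C r) ⟨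
        ∑[ y < k ] (if freshAbove F x y then count (above (freshAbove F x) y) C r else 0)
          ≡⟨ ∑-if-cong (freshAbove F x) (λ y eligible → cong (_C r)
               (count-cong (λ z → sym (above-unused F x y (freshAbove⇒≮ᵇ F x y eligible) z)))) ⟩
        ∑[ y < k ] (if freshAbove F x y then W y else 0)                       ∎
      -- Both parts consist of increasing continuations; together they range over all unused
      -- letters, so they add up to (r + 1) C (r + 1).
      below-and-above : Σᶻ + c ≡ 1
      below-and-above = begin
        Σᶻ + c
          ≡⟨ cong₂ _+_ below above-x ⟩
        ∑[ y < k ] (if (toℕ y <ᵇ toℕ x) ∧ not (F y) then W y else 0) + ∑[ y < k ] (if freshAbove F x y then W y else 0)
          ≡⟨ ∑-distrib-+ {k} _ _ ⟨
        ∑[ y < k ] ((if (toℕ y <ᵇ toℕ x) ∧ not (F y) then W y else 0) + (if freshAbove F x y then W y else 0))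
          ≡⟨ sum-cong-≗ (λ y → if-∧-split (toℕ y <ᵇ toℕ x) (not (F y)) (W y)) ⟩
        ∑[ y < k ] (if unused F y then W y else 0)
          ≡⟨ ∑-over-ranks (unused F) (_C r) ⟩
        ∑[ t < count (unused F) ] (toℕ t C r)
          ≡⟨ hockey-stick r (count (unused F)) ⟩
        count (unused F) C suc r
          ≡⟨ cong (_C suc r) unused≡ ⟩
        suc r C suc r
          ≡⟨ nCn≡1 (suc r) ⟩
        1 ∎

    completions-ascents : ∀ j r (x : Fin k) F → count (unused F) ≡ j + r →
      completions (hasForm (replicate j false)) x F (j + r) + deficit j r (count (freshAbove F x))
        ≡ 2 ^ count (freshAbove F x)
    completions-ascents zero    r x F unused≡ = completions-oneDescent r x F unused≡
    completions-ascents (suc j) r x F unused≡ = begin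
      completions (hasForm (replicate (suc j) false)) x F (suc j + r) + deficit (suc j) r a
        ≡⟨ cong (_+ deficit (suc j) r a)
             (completions-ascent (hasForm (replicate (suc j) false)) Q x F (j + r) (λ _ → refl) (λ _ → refl)) ⟩
      ∑[ y < k ] (if freshAbove F x y then next y else 0) + deficit (suc j) r a
        ≡⟨ deficit-step (freshAbove F x) next j r (λ y eligible →
             subst (λ t → next y + deficit j r t ≡ 2 ^ t) (count-freshAbove-∪ F x y eligible)
               (completions-ascents j r y (F ∪｛ y ｝) (count-unused-∪-freshAbove F x y unused≡ eligible))) ⟩
      2 ^ a ∎
      where
      Q : BinStr → Bool
      Q = hasForm (replicate j false)
      next : Fin k → ℕ
      next y = completions Q y (F ∪｛ y ｝) (j + r)
      a : ℕ
      a = count (freshAbove F x)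

  f-as-completions : ∀ p m → f p (suc m) ≡ ∑[ x < suc m ] completions (hasForm p) x (∅ ∪｛ x ｝) m
  f-as-completions p m = begin
    f p (suc m)
      ≡⟨ length-filter-filter (λ π → distinct (toList π)) (λ π → hasForm p (index π)) (words (suc m) (suc m)) ⟩
    ∑ˡ (List.map (λ π → iverson (distinct (toList π) ∧ hasForm p (index π))) (words (suc m) (suc m)))
      ≡⟨ sum-map-words (suc m) (suc m) _ ⟩
    sumWords (suc m) (λ π → iverson (distinct (toList π) ∧ hasForm p (index π)))
      ≡⟨ sum-cong-≗ (λ x → sumWords-cong m (λ v → cong iverson (first-letter x (toList v)))) ⟩
    ∑[ x < suc m ] completions (hasForm p) x (∅ ∪｛ x ｝) m ∎
    where
    first-letter : ∀ x l → distinct (x ∷ l) ∧ hasForm p (indexL (x ∷ l))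
      ≡ fresh (∅ ∪｛ x ｝) l ∧ distinct l ∧ hasForm p (indexL (x ∷ l))
    first-letter x l rewrite fresh-∪ ∅ x l | fresh-∅ l =
      ∧-assoc (not (any (λ z → isYes (x ≟ z)) l)) (distinct l) (hasForm p (indexL (x ∷ l)))

  f-ascents : ∀ j r → f (replicate j false) (suc (j + r)) + deficit (suc j) r (suc (j + r)) ≡ 2 ^ suc (j + r)
  f-ascents j r = begin
    f (replicate j false) n + deficit (suc j) r n
      ≡⟨ cong (_+ deficit (suc j) r n) (f-as-completions (replicate j false) (j + r)) ⟩
    ∑[ x < n ] start x + deficit (suc j) r n
      ≡⟨ subst (λ c → ∑[ x < n ] start x + deficit (suc j) r c ≡ 2 ^ c) (count-all n)
           (deficit-step (λ _ → true) start j r (λ x _ →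
              subst (λ t → start x + deficit j r t ≡ 2 ^ t) (count-cong (freshAbove-∪ ∅ x))
                (completions-ascents j r x (∅ ∪｛ x ｝)
                  (suc-injective (trans (sym (count-unused-∪ ∅ x refl)) (count-all n)))))) ⟩
    2 ^ n ∎
    where
    n : ℕ
    n = suc (j + r)
    start : Fin n → ℕ
    start x = completions (hasForm (replicate j false)) x (∅ ∪｛ x ｝) (j + r)

  2*nC2+n≡n*n : ∀ n → 2 * (n C 2) + n ≡ n * n
  2*nC2+n≡n*n zero    = refl
  2*nC2+n≡n*n (suc n) = begin
    2 * (suc n C 2) + suc n            ≡⟨ cong (λ t → 2 * t + suc n) (nCk+nC[k+1]≡[n+1]C[k+1] n 1) ⟨
    2 * (n C 1 + n C 2) + suc n        ≡⟨ cong (λ t → 2 * (t + n C 2) + suc n) (nC1≡n n) ⟩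
    2 * (n + n C 2) + suc n            ≡⟨ regroup n (n C 2) ⟩
    (2 * (n C 2) + n) + suc (2 * n)    ≡⟨ cong (_+ suc (2 * n)) (2*nC2+n≡n*n n) ⟩
    n * n + suc (2 * n)                ≡⟨ square n ⟩
    suc n * suc n                      ∎
    where
    regroup : ∀ n d → 2 * (n + d) + suc n ≡ (2 * d + n) + suc (2 * n)
    regroup = solve-∀
    square : ∀ n → n * n + suc (2 * n) ≡ suc n * suc n
    square = solve-∀

  2*f00+n*n+3*n≡2*2^n+2 : ∀ r → let n = 3 + r in 2 * f (false ∷ false ∷ []) n + n * n + 3 * n ≡ 2 * 2 ^ n + 2
  2*f00+n*n+3*n≡2*2^n+2 r = begin
    2 * F + n * n + 3 * n                                   ≡⟨ cong (λ t → 2 * F + t + 3 * n) (2*nC2+n≡n*n n) ⟨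
    2 * F + (2 * (n C 2) + n) + 3 * n                       ≡⟨ regroup F (n C 2) r ⟩
    2 * (F + (1 * suc r + (1 + (n + (n C 2 + 0))))) + 2     ≡⟨ cong (λ t → 2 * (F + t) + 2) binomials ⟩
    2 * (F + deficit 3 r n) + 2                             ≡⟨ cong (λ t → 2 * t + 2) (f-ascents 2 r) ⟩
    2 * 2 ^ n + 2                                           ∎
    where
    n F : ℕ
    n = 3 + r
    F = f (false ∷ false ∷ []) n
    regroup : ∀ F d r → 2 * F + (2 * d + (3 + r)) + 3 * (3 + r) ≡ 2 * (F + (1 * suc r + (1 + ((3 + r) + (d + 0))))) + 2
    regroup = solve-∀
    binomials : 1 * suc r + (1 + (n + (n C 2 + 0))) ≡ deficit 3 r n
    binomials = cong₂ (λ u v → u * suc r + (1 + (v + (n C 2 + 0)))) (sym (nCn≡1 n)) (sym (nC1≡n n))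

open AscentPrefixes using (2*f00+n*n+3*n≡2*2^n+2)

open import Defs
open import Data.Bool using (false)
open import Data.List using (_∷_; [])
open import Data.Nat as ℕ using (ℕ; _≥_; zero; suc; s≤s)
open import Data.Integer using (+_; _+_; _-_; _*_; _^_)
open import Data.Integer.Properties using (pos-+; pos-*)
open import Data.Integer.Tactic.RingSolver using (solve-∀)
open import Relation.Binary.PropositionalEquality using (_≡_; refl; sym; trans; cong; cong₂)
open Relation.Binary.PropositionalEquality.≡-Reasoning

pos-^ : ∀ m n → (+ m) ^ n ≡ + (m ℕ.^ n)
pos-^ m zero    = refl
pos-^ m (suc n) = trans (cong (+ m *_) (pos-^ m n)) (sym (pos-* m (m ℕ.^ n)))

isolate-2*F : ∀ F n P → 2 ℕ.* F ℕ.+ n ℕ.* n ℕ.+ 3 ℕ.* n ≡ 2 ℕ.* P ℕ.+ 2 →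
  + 2 * + F ≡ + 2 * + P - + n * + n - + 3 * + n + + 2
isolate-2*F F n P eq = begin
  + 2 * + F                                         ≡⟨ isolate (+ F) (+ n) ⟩
  (+ 2 * + F + + n * + n + + 3 * + n) - + n * + n - + 3 * + n
    ≡⟨ cong (λ t → t - + n * + n - + 3 * + n) (trans (sym cast) (cong +_ eq)) ⟩
  + (2 ℕ.* P ℕ.+ 2) - + n * + n - + 3 * + n        ≡⟨ cong (λ t → t - + n * + n - + 3 * + n) (pos-+ (2 ℕ.* P) 2) ⟩
  + (2 ℕ.* P) + + 2 - + n * + n - + 3 * + n        ≡⟨ cong (λ t → t + + 2 - + n * + n - + 3 * + n) (pos-* 2 P) ⟩
  + 2 * + P + + 2 - + n * + n - + 3 * + n          ≡⟨ move (+ 2 * + P) (+ n) ⟩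
  + 2 * + P - + n * + n - + 3 * + n + + 2          ∎
  where
  isolate : ∀ F n → + 2 * F ≡ (+ 2 * F + n * n + + 3 * n) - n * n - + 3 * n
  isolate = solve-∀
  move : ∀ X n → X + + 2 - n * n - + 3 * n ≡ X - n * n - + 3 * n + + 2
  move = solve-∀
  cast : + (2 ℕ.* F ℕ.+ n ℕ.* n ℕ.+ 3 ℕ.* n) ≡ + 2 * + F + + n * + n + + 3 * + n
  cast = trans (pos-+ (2 ℕ.* F ℕ.+ n ℕ.* n) (3 ℕ.* n))
    (cong₂ _+_ (trans (pos-+ (2 ℕ.* F) (n ℕ.* n)) (cong₂ _+_ (pos-* 2 F) (pos-* n n))) (pos-* 3 n))

lemma4p3 : (n : ℕ) → n ≥ 2 →
    + 2 * + f (false ∷ false ∷ []) n ≡ + 2 * ((+ 2) ^ n) - + n * + n - + 3 * + n + + 2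
lemma4p3 (suc zero)          (s≤s ())
lemma4p3 (suc (suc zero))    _ = refl
lemma4p3 (suc (suc (suc r))) _ = begin
  + 2 * + f (false ∷ false ∷ []) n                      ≡⟨ isolate-2*F (f (false ∷ false ∷ []) n) n (2 ℕ.^ n) (2*f00+n*n+3*n≡2*2^n+2 r) ⟩
  + 2 * + (2 ℕ.^ n) - + n * + n - + 3 * + n + + 2       ≡⟨ cong (λ t → + 2 * t - + n * + n - + 3 * + n + + 2) (pos-^ 2 n) ⟨
  + 2 * ((+ 2) ^ n) - + n * + n - + 3 * + n + + 2       ∎
  where
  n : ℕ
  n = 3 ℕ.+ r
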